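{- Let $p$ be a prime number and let $a$ be an integer that is not a multiple of $p$. Then the sequence $$\left(\vartheta_p\left(\sum_{k=1}^{n}\left(\frac{1}{a^k}+\frac{1}{(p-a)^k}\right)\frac{p^k}{k}\right)\right)_{n\ge1}$$ is unbounded from above.
   Context: For a prime $p$ and a nonzero rational number $r$, $\vartheta_p(r)$ denotes the $p$-adic valuation of $r$. -}

module Defs where

open import Data.Nat as ℕ using (ℕ; zero; suc)
open import Data.Nat.Divisibility using (_∣?_; _∣_)
open import Data.Integer as ℤ using (ℤ; +_)
open import Data.Rational as ℚ using (ℚ; 0ℚ; 1ℚ; _+_; _*_; ↥_; ↧ₙ_)
open import Data.Rational.Properties using (_≟_)
open import Relation.Nullary using (yes; no)

fromℤ : ℤ → ℚ
fromℤ z = z ℚ./ 1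

_^ℚ_ : ℚ → ℕ → ℚ
q ^ℚ zero  = 1ℚ
q ^ℚ suc n = q * (q ^ℚ n)

-- reciprocal in ℚ; only ever applied to nonzero arguments below
-- (the value at 0 is an irrelevant junk value 0)
inv : ℚ → ℚ
inv q with q ≟ 0ℚ
... | yes _ = 0ℚ
... | no q≢0 = ℚ.1/_ q {{ℚ.≢-nonZero q≢0}}

-- p-adic valuation of a positive natural number n:
-- number of times p divides n (fuel = n suffices, since p ≥ 2 and p^n > n)
vℕ-fuel : ℕ → ℕ → ℕ → ℕ
vℕ-fuel p zero    n = 0
vℕ-fuel p (suc f) n with p ∣? n
... | yes p∣n = suc (vℕ-fuel p f (_∣_.quotient p∣n))
... | no  _ = 0

vℕ : ℕ → ℕ → ℕ
vℕ p n = vℕ-fuel p n n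

-- p-adic valuation of a rational r (meaningful for r ≠ 0; ϑ p 0 = 0 is junk):
-- ϑ_p(num/den) = v_p(|num|) - v_p(den)
ϑ : ℕ → ℚ → ℤ
ϑ p r = + vℕ p ℤ.∣ ↥ r ∣ ℤ.- + vℕ p (↧ₙ r)

term : ℕ → ℤ → ℕ → ℚ
term p a k =
  (inv (fromℤ a ^ℚ k) + inv (fromℤ (+ p ℤ.- a) ^ℚ k))
    * (fromℤ (+ p) ^ℚ k) * inv (fromℤ (+ k))

S : ℕ → ℤ → ℕ → ℚ
S p a zero    = 0ℚ
S p a (suc n) = S p a n + term p a (suc n)

-- x = p/a and y = p/(p-a) satisfy x + y = x y =: e, and e = p²/(a(p-a)) has valuation 2.
-- S_n = Σ_{k≤n} (x^k + y^k)/k truncates -log((1-x)(1-y)) = -log(1 - e + e) = 0, and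
-- expanding x^k + y^k in e (Waring's formula) and regrouping makes this explicit:
--   S_n = Σ_{m+r=n} (e^m/m) (-1)^r C(m-1,r).
-- For n = 2K the terms with m ≤ K vanish because r ≥ K ≥ m, while the others have
-- valuation at least 2m - ϑ_p(m) ≥ m > K. Hence S_{2K} = 0 or ϑ_p(S_{2K}) ≥ K.

module Submission where

open import Defs
open import Data.Nat using (ℕ; _≥_; zero; suc)
open import Data.Nat.Primality using (Prime)
open import Data.Integer using (ℤ; +_; _<_)
open import Data.Integer.Divisibility using (_∣_)
open import Data.Rational using (0ℚ)
open import Data.Product using (∃; _×_; Σ; _,_)
open import Data.Sum using (_⊎_; inj₁; inj₂)
open import Relation.Nullary using (¬_; yes; no; contradiction)
open import Relation.Binary.PropositionalEquality using (_≡_; _≢_; refl; sym; trans; cong; cong₂; subst; module ≡-Reasoning)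
open import Relation.Nullary.Decidable using (dec⇒maybe)
import Data.Nat as ℕ
import Data.Nat.Properties as ℕP
import Data.Nat.Divisibility as ℕD
import Data.Integer as ℤ
import Data.Integer.Properties as ℤP
import Data.Integer.Divisibility.Signed as ℤD
import Data.Rational as ℚ
import Data.Rational.Properties as ℚP
import Data.Rational.Unnormalised.Properties as ℚᵘP
open import Tactic.RingSolver.Core.AlmostCommutativeRing using (AlmostCommutativeRing; fromCommutativeRing)
import Data.Integer.Tactic.RingSolver as ℤSolver
import Tactic.RingSolver as RingSolver

module Valuation where
  open import Data.Nat hiding (_<_)
  open import Data.Nat.Properties
  open import Data.Nat.Divisibility using (divides; _∣?_)
  open import Data.Nat.Induction using (<-rec)
  open import Data.Nat.Primality using (euclidsLemma; prime⇒nonTrivial)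
  open import Data.Nat.Tactic.RingSolver using (solve-∀)
  open ≡-Reasoning

  Factorization : ℕ → ℕ → Set
  Factorization p n = Σ ℕ λ v → Σ ℕ λ u → n ≡ p ^ v * u × ¬ p ℕD.∣ u

  module _ {p : ℕ} (p>1 : p > 1) where

    private instance
      p≢0 : NonZero p
      p≢0 = >-nonZero (<-trans z<s p>1)

    p^v*u>0 : ∀ v {u} → ¬ p ℕD.∣ u → p ^ v * u > 0
    p^v*u>0 v {zero}  p∤0 = contradiction (divides 0 refl) p∤0
    p^v*u>0 v {suc u} _   = *-mono-< (m^n>0 p v) z<s

    factorOut : ∀ n → n > 0 → Factorization p n
    factorOut = <-rec _ go
      where
      go : ∀ n → (∀ {m} → n > m → m > 0 → Factorization p m) → n > 0 → Factorization p n
      go n rec n>0 with p ∣? n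
      ... | no p∤n = 0 , n , sym (*-identityˡ n) , p∤n
      ... | yes (divides q n≡q*p) with q>0 ← n≢0⇒n>0 (λ { refl → >⇒≢ n>0 n≡q*p })
                                  | rec (subst (_> q) (sym n≡q*p) (m<m*n q p {{>-nonZero q>0}} p>1)) q>0
      ...   | v , u , q≡p^v*u , p∤u = suc v , u , (begin
              n             ≡⟨ n≡q*p ⟩
              q * p         ≡⟨ *-comm q p ⟩
              p * q         ≡⟨ cong (p *_) q≡p^v*u ⟩
              p * (p ^ v * u) ≡⟨ *-assoc p (p ^ v) u ⟨
              p ^ suc v * u ∎) , p∤u

    vℕ-fuel-p^v*u : ∀ {u} → ¬ p ℕD.∣ u → ∀ v f → p ^ v * u ≤ f → vℕ-fuel p f (p ^ v * u) ≡ v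
    vℕ-fuel-p^v*u p∤u v zero le = contradiction (n≤0⇒n≡0 le) (>⇒≢ (p^v*u>0 v p∤u))
    vℕ-fuel-p^v*u {u} p∤u zero (suc f) le with p ∣? (1 * u)
    ... | yes p∣u = contradiction (subst (p ℕD.∣_) (*-identityˡ u) p∣u) p∤u
    ... | no _    = refl
    vℕ-fuel-p^v*u {u} p∤u (suc v) (suc f) le with p ∣? (p ^ suc v * u)
    ... | no p∤ = contradiction (divides (p ^ v * u) (trans (*-assoc p (p ^ v) u) (*-comm p _))) p∤
    ... | yes (divides q eq) = cong suc (subst (λ n → vℕ-fuel p f n ≡ v) (sym q≡) (vℕ-fuel-p^v*u p∤u v f (≤-pred (<-≤-trans smaller le))))
      where
      q≡ : q ≡ p ^ v * u
      q≡ = *-cancelʳ-≡ q (p ^ v * u) p (trans (sym eq) (trans (*-assoc p (p ^ v) u) (*-comm p _)))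
      smaller : p ^ suc v * u > p ^ v * u
      smaller = subst (_> p ^ v * u) (trans (*-comm _ p) (sym (*-assoc p (p ^ v) u)))
                      (m<m*n (p ^ v * u) p {{>-nonZero (p^v*u>0 v p∤u)}} p>1)

    vℕ-unique : ∀ {n v u} → n ≡ p ^ v * u → ¬ p ℕD.∣ u → vℕ p n ≡ v
    vℕ-unique {v = v} refl p∤u = vℕ-fuel-p^v*u p∤u v _ ≤-refl

  vℕ-fuel≤fuel : ∀ p f n → vℕ-fuel p f n ≤ f
  vℕ-fuel≤fuel p zero    n = z≤n
  vℕ-fuel≤fuel p (suc f) n with p ∣? n
  ... | yes (divides q _) = s≤s (vℕ-fuel≤fuel p f q)
  ... | no _              = z≤n

  prime⇒>1 : ∀ {p} → Prime p → p > 1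
  prime⇒>1 {p} p-prime = nonTrivial⇒n>1 p {{prime⇒nonTrivial p-prime}}

  >1⇒∤1 : ∀ {p} → p > 1 → ¬ p ℕD.∣ 1
  >1⇒∤1 p>1 p∣1 = >⇒≢ p>1 (ℕD.∣1⇒≡1 p∣1)

  module _ {p : ℕ} (p-prime : Prime p) where

    private
      p>1 : p > 1
      p>1 = prime⇒>1 p-prime

    prime∤* : ∀ {m n} → ¬ p ℕD.∣ m → ¬ p ℕD.∣ n → ¬ p ℕD.∣ m * n
    prime∤* {m} {n} p∤m p∤n p∣mn with euclidsLemma m n p-prime p∣mn
    ... | inj₁ p∣m = p∤m p∣m
    ... | inj₂ p∣n = p∤n p∣n

    vℕ-* : ∀ {m n} → m > 0 → n > 0 → vℕ p (m * n) ≡ vℕ p m + vℕ p n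
    vℕ-* {m} {n} m>0 n>0 with factorOut p>1 m m>0 | factorOut p>1 n n>0
    ... | v , u , refl , p∤u | w , t , refl , p∤t = begin
        vℕ p (p ^ v * u * (p ^ w * t))      ≡⟨ vℕ-unique p>1 mn≡ (prime∤* p∤u p∤t) ⟩
        v + w                               ≡⟨ cong₂ _+_ (vℕ-unique p>1 {v = v} refl p∤u) (vℕ-unique p>1 {v = w} refl p∤t) ⟨
        vℕ p (p ^ v * u) + vℕ p (p ^ w * t) ∎
      where
      interchange : ∀ a b c d → a * b * (c * d) ≡ a * c * (b * d)
      interchange = solve-∀
      mn≡ : p ^ v * u * (p ^ w * t) ≡ p ^ (v + w) * (u * t)
      mn≡ = trans (interchange (p ^ v) u (p ^ w) t) (cong (_* (u * t)) (sym (^-distribˡ-+-* p v w)))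

    vℕ-cross : ∀ {n d c m K} → n > 0 → d > 0 → ¬ p ℕD.∣ d → m > 0 →
               n * d ≡ p ^ K * c * m → vℕ p n ≡ K + vℕ p c + vℕ p m
    vℕ-cross {n} {d} {c} {m} {K} n>0 d>0 p∤d m>0 nd≡ = begin
        vℕ p n                          ≡⟨ +-identityʳ (vℕ p n) ⟨
        vℕ p n + 0                      ≡⟨ cong (λ k → vℕ p n + k) (vℕ-unique p>1 {v = 0} (sym (*-identityˡ d)) p∤d) ⟨
        vℕ p n + vℕ p d                 ≡⟨ vℕ-* n>0 d>0 ⟨
        vℕ p (n * d)                    ≡⟨ cong (vℕ p) nd≡ ⟩
        vℕ p (p ^ K * c * m)            ≡⟨ vℕ-* (*-mono-< p^K>0 c>0) m>0 ⟩
        vℕ p (p ^ K * c) + vℕ p m       ≡⟨ cong (_+ vℕ p m) (vℕ-* p^K>0 c>0) ⟩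
        vℕ p (p ^ K) + vℕ p c + vℕ p m  ≡⟨ cong (λ k → k + vℕ p c + vℕ p m) (vℕ-unique p>1 (sym (*-identityʳ (p ^ K))) (>1⇒∤1 p>1)) ⟩
        K + vℕ p c + vℕ p m ∎
      where
      p^K>0 : p ^ K > 0
      p^K>0 = m^n>0 p {{>-nonZero (<-trans z<s p>1)}} K
      c>0 : c > 0
      c>0 = n≢0⇒n>0 λ { refl → >⇒≢ (*-mono-< n>0 d>0) (trans nd≡ (cong (_* m) (*-zeroʳ (p ^ K)))) }

module SignedBinomial where
  open import Data.Nat using (ℕ; zero; suc; _>_; s≤s)
  open import Data.Nat.Properties using (m<n⇒m<1+n)
  open import Data.Integer using (ℤ; +_; _+_; _-_; _*_)
  open import Data.Integer.Properties using (pos-+; +-identityʳ)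
  open import Data.Integer.Tactic.RingSolver using (solve-∀)
  open ≡-Reasoning

  -- β m j = (-1)^j C(m,j)
  β : ℕ → ℕ → ℤ
  β _       zero    = + 1
  β zero    (suc j) = + 0
  β (suc m) (suc j) = β m (suc j) - β m j

  β-vanish : ∀ {m j} → j > m → β m j ≡ + 0
  β-vanish {zero}  {suc j} _       = refl
  β-vanish {suc m} {suc j} (s≤s m<j) rewrite β-vanish (m<n⇒m<1+n m<j) | β-vanish m<j = refl

  alternatingSum : ℕ → ℕ → ℤ
  alternatingSum m zero    = β m zero
  alternatingSum m (suc r) = alternatingSum m r + β m (suc r)

  alternatingSum-suc : ∀ m r → alternatingSum (suc m) r ≡ β m r
  alternatingSum-suc m zero    = refl
  alternatingSum-suc m (suc r) rewrite alternatingSum-suc m r = telescope (β m r) (β m (suc r))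
    where
    telescope : ∀ u v → u + (v - u) ≡ v
    telescope = solve-∀

  β-absorption : ∀ m j → + suc j * β (suc m) (suc j) + + suc m * β m j ≡ + 0
  β-absorption zero    zero    = refl
  β-absorption zero    (suc j) = cong (_+ + 0) (ℤP.*-zeroʳ (+ suc (suc j)))
  β-absorption (suc m) zero    = trans (shift (β (suc m) 1) (+ m)) (β-absorption m 0)
    where
    shift : ∀ b k → + 1 * (b - + 1) + (+ 2 + k) * + 1 ≡ + 1 * b + (+ 1 + k) * + 1
    shift = solve-∀
  β-absorption (suc m) (suc j) = begin
      (+ 2 + + j) * (b - (u - v)) + (+ 2 + + m) * (u - v)
        ≡⟨ regroup (+ j) (+ m) b u v ⟩
      ((+ 2 + + j) * b + (+ 1 + + m) * u) - ((+ 1 + + j) * (u - v) + (+ 1 + + m) * v)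
        ≡⟨ cong₂ _-_ (β-absorption m (suc j)) (β-absorption m j) ⟩
      + 0 ∎
    where
    b = β (suc m) (suc (suc j))
    u = β m (suc j)
    v = β m j
    regroup : ∀ J M b u v → (+ 2 + J) * (b - (u - v)) + (+ 2 + M) * (u - v)
           ≡ ((+ 2 + J) * b + (+ 1 + M) * u) - ((+ 1 + J) * (u - v) + (+ 1 + M) * v)
    regroup = solve-∀

  -- ω m j is the coefficient of e^m in x^(m+j) + y^(m+j) whenever x + y = x y = e
  ω : ℕ → ℕ → ℤ
  ω zero    zero    = + 2
  ω zero    (suc j) = + 0
  ω (suc m) zero    = + 1
  ω (suc m) (suc j) = β (suc m) (suc j) - β m j

  ω-suc-suc : ∀ m j → ω (suc m) (suc j) ≡ ω m (suc j) - ω m j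
  ω-suc-suc zero    zero    = refl
  ω-suc-suc zero    (suc j) = refl
  ω-suc-suc (suc m) zero    = refl
  ω-suc-suc (suc m) (suc j) = regroup (β (suc m) (suc (suc j))) (β m (suc j)) (β m j)
    where
    regroup : ∀ b u v → (b - (u - v)) - (u - v) ≡ (b - u) - ((u - v) - v)
    regroup = solve-∀

  ω-β : ∀ m j → + suc m * ω (suc m) j ≡ + (suc m ℕ.+ j) * β (suc m) j
  ω-β m zero    rewrite ℕP.+-identityʳ m = refl
  ω-β m (suc j) = begin
      + suc m * (b - v)                                  ≡⟨ regroup (+ suc m) (+ suc j) b v ⟩
      (+ suc m + + suc j) * b - (+ suc j * b + + suc m * v) ≡⟨ cong₂ _-_ (cong (_* b) (sym (pos-+ (suc m) (suc j)))) (β-absorption m j) ⟩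
      + (suc m ℕ.+ suc j) * b - + 0                       ≡⟨ +-identityʳ _ ⟩
      + (suc m ℕ.+ suc j) * b ∎
    where
    b = β (suc m) (suc j)
    v = β m j
    regroup : ∀ M J b v → M * (b - v) ≡ (M + J) * b - (J * b + M * v)
    regroup = solve-∀

module RationalArithmetic where
  open import Data.Rational using (ℚ; 1ℚ; _+_; _*_; _-_; -_; toℚᵘ)
  open import Data.Rational.Unnormalised using (_≃_; *≡*; mkℚᵘ)
  open import Data.Rational.Unnormalised.Properties using (≃-trans; ≃-sym; ≃-reflexive; +-cong; *-cong; -‿cong)
  open import Tactic.RingSolver using (solve-∀)
  open ≡-Reasoning

  ℚ-ring : AlmostCommutativeRing _ _
  ℚ-ring = fromCommutativeRing ℚP.+-*-commutativeRing (λ q → dec⇒maybe (0ℚ ℚP.≟ q))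

  toℚᵘ-fromℤ : ∀ z → toℚᵘ (fromℤ z) ≃ mkℚᵘ z 0
  toℚᵘ-fromℤ z = ℚP.toℚᵘ-fromℚᵘ (mkℚᵘ z 0)

  fromℤ-≃ : ∀ {z q} → toℚᵘ q ≃ mkℚᵘ z 0 → fromℤ z ≡ q
  fromℤ-≃ {z} q≃z = ℚP.toℚᵘ-injective (≃-trans (toℚᵘ-fromℤ z) (≃-sym q≃z))

  fromℤ-+ : ∀ z w → fromℤ (z ℤ.+ w) ≡ fromℤ z + fromℤ w
  fromℤ-+ z w = fromℤ-≃ {z ℤ.+ w} (≃-trans (ℚP.toℚᵘ-homo-+ (fromℤ z) (fromℤ w))
                                  (≃-trans (+-cong (toℚᵘ-fromℤ z) (toℚᵘ-fromℤ w)) (*≡* (denominators z w))))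
    where
    denominators : ∀ z w → (z ℤ.* + 1 ℤ.+ w ℤ.* + 1) ℤ.* + 1 ≡ (z ℤ.+ w) ℤ.* + 1
    denominators = ℤSolver.solve-∀

  fromℤ-* : ∀ z w → fromℤ (z ℤ.* w) ≡ fromℤ z * fromℤ w
  fromℤ-* z w = fromℤ-≃ {z ℤ.* w} (≃-trans (ℚP.toℚᵘ-homo-* (fromℤ z) (fromℤ w))
                                  (≃-trans (*-cong (toℚᵘ-fromℤ z) (toℚᵘ-fromℤ w)) (*≡* refl)))

  fromℤ-neg : ∀ z → fromℤ (ℤ.- z) ≡ - fromℤ z
  fromℤ-neg z = fromℤ-≃ {ℤ.- z} (≃-trans (ℚP.toℚᵘ-homo‿- (fromℤ z)) (≃-trans (-‿cong (toℚᵘ-fromℤ z)) (*≡* refl)))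

  fromℤ-minus : ∀ z w → fromℤ (z ℤ.- w) ≡ fromℤ z - fromℤ w
  fromℤ-minus z w = trans (fromℤ-+ z (ℤ.- w)) (cong (λ t → fromℤ z + t) (fromℤ-neg w))

  fromℤ-injective : ∀ {z w} → fromℤ z ≡ fromℤ w → z ≡ w
  fromℤ-injective {z} {w} eq with ≃-trans (≃-sym (toℚᵘ-fromℤ z)) (≃-trans (≃-reflexive (cong toℚᵘ eq)) (toℚᵘ-fromℤ w))
  ... | *≡* z*1≡w*1 = trans (sym (ℤP.*-identityʳ z)) (trans z*1≡w*1 (ℤP.*-identityʳ w))

  fromℤ-nonZero : ∀ {z} → z ≢ + 0 → fromℤ z ≢ 0ℚ
  fromℤ-nonZero z≢0 eq = z≢0 (fromℤ-injective eq)

  inv-inverseˡ : ∀ {q} → q ≢ 0ℚ → inv q * q ≡ 1ℚ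
  inv-inverseˡ {q} q≢0 with q ℚP.≟ 0ℚ
  ... | yes q≡0 = contradiction q≡0 q≢0
  ... | no  _   = ℚP.*-inverseˡ q {{ℚ.≢-nonZero q≢0}}

  inv-inverseʳ : ∀ {q} → q ≢ 0ℚ → q * inv q ≡ 1ℚ
  inv-inverseʳ {q} q≢0 = trans (ℚP.*-comm q (inv q)) (inv-inverseˡ q≢0)

  *-cancelʳ : ∀ {u v w} → w ≢ 0ℚ → u * w ≡ v * w → u ≡ v
  *-cancelʳ {u} {v} {w} w≢0 eq = begin
    u                 ≡⟨ unit u ⟩
    u * w * inv w     ≡⟨ cong (_* inv w) eq ⟩
    v * w * inv w     ≡⟨ unit v ⟨
    v ∎
    where
    unit : ∀ t → t ≡ t * w * inv w
    unit t = sym (trans (ℚP.*-assoc t w (inv w)) (trans (cong (t *_) (inv-inverseʳ w≢0)) (ℚP.*-identityʳ t)))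

  *-nonZero : ∀ {u v} → u ≢ 0ℚ → v ≢ 0ℚ → u * v ≢ 0ℚ
  *-nonZero {u} {v} u≢0 v≢0 uv≡0 = u≢0 (*-cancelʳ v≢0 (trans uv≡0 (sym (ℚP.*-zeroˡ v))))

  ^-nonZero : ∀ {u} k → u ≢ 0ℚ → u ^ℚ k ≢ 0ℚ
  ^-nonZero zero    _   ()
  ^-nonZero (suc k) u≢0 = *-nonZero u≢0 (^-nonZero k u≢0)

  ^-distribʳ-* : ∀ u v k → (u * v) ^ℚ k ≡ u ^ℚ k * v ^ℚ k
  ^-distribʳ-* u v zero    = refl
  ^-distribʳ-* u v (suc k) = trans (cong (u * v *_) (^-distribʳ-* u v k)) (interchange u v (u ^ℚ k) (v ^ℚ k))
    where
    interchange : ∀ a b c d → a * b * (c * d) ≡ a * c * (b * d)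
    interchange = solve-∀ ℚ-ring

  1^k≡1 : ∀ k → 1ℚ ^ℚ k ≡ 1ℚ
  1^k≡1 zero    = refl
  1^k≡1 (suc k) = trans (ℚP.*-identityˡ _) (1^k≡1 k)

  inv-^ : ∀ {u} k → u ≢ 0ℚ → inv (u ^ℚ k) ≡ inv u ^ℚ k
  inv-^ {u} k u≢0 = *-cancelʳ (^-nonZero k u≢0) (begin
    inv (u ^ℚ k) * u ^ℚ k   ≡⟨ inv-inverseˡ (^-nonZero k u≢0) ⟩
    1ℚ                      ≡⟨ 1^k≡1 k ⟨
    1ℚ ^ℚ k                 ≡⟨ cong (_^ℚ k) (inv-inverseˡ u≢0) ⟨
    (inv u * u) ^ℚ k        ≡⟨ ^-distribʳ-* (inv u) u k ⟩
    inv u ^ℚ k * u ^ℚ k ∎)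

  *-inv-cross : ∀ {w b M K} → M ≢ 0ℚ → K ≢ 0ℚ → M * w ≡ K * b → w * inv K ≡ b * inv M
  *-inv-cross {w} {b} {M} {K} M≢0 K≢0 Mw≡Kb = *-cancelʳ (*-nonZero M≢0 K≢0) (begin
    w * inv K * (M * K)       ≡⟨ regroup w (inv K) M K ⟩
    (M * w) * (K * inv K)     ≡⟨ cong₂ _*_ Mw≡Kb (inv-inverseʳ K≢0) ⟩
    (K * b) * 1ℚ              ≡⟨ cong ((K * b) *_) (inv-inverseʳ M≢0) ⟨
    (K * b) * (M * inv M)     ≡⟨ regroup b (inv M) K M ⟨
    b * inv M * (K * M)       ≡⟨ cong (b * inv M *_) (ℚP.*-comm K M) ⟩
    b * inv M * (M * K) ∎)
    where
    regroup : ∀ w i M K → w * i * (M * K) ≡ (M * w) * (K * i)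
    regroup = solve-∀ ℚ-ring

  fromℤ-suc≢0 : ∀ n → fromℤ (+ suc n) ≢ 0ℚ
  fromℤ-suc≢0 n = fromℤ-nonZero {+ suc n} (λ ())

  *fromℤ≡fromℤ⇒cross : ∀ q d z → q * fromℤ d ≡ fromℤ z → ℚ.↥ q ℤ.* d ≡ z ℤ.* ℚ.↧ q
  *fromℤ≡fromℤ⇒cross q@(ℚ.mkℚ _ _ _) d z eq
    with ≃-trans (*-cong (ℚᵘP.≃-refl {toℚᵘ q}) (≃-sym (toℚᵘ-fromℤ d)))
           (≃-trans (≃-sym (ℚP.toℚᵘ-homo-* q (fromℤ d))) (≃-trans (≃-reflexive (cong toℚᵘ eq)) (toℚᵘ-fromℤ z)))
  ... | *≡* cross = trans (sym (ℤP.*-identityʳ _)) (trans cross (cong (z ℤ.*_) (ℤP.*-identityʳ (ℚ.↧ q))))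

module AntidiagonalSum where
  open import Data.Nat using (ℕ; zero; suc; _+_)
  open import Data.Nat.Properties using (+-identityʳ; +-suc)
  open import Data.Rational using (ℚ) renaming (_+_ to _+ℚ_)
  open RationalArithmetic using (ℚ-ring)
  open import Tactic.RingSolver using (solve-∀)
  open import Algebra.Bundles using (CommutativeMonoid)
  open import Algebra.Properties.CommutativeSemigroup (CommutativeMonoid.commutativeSemigroup ℚP.+-0-commutativeMonoid)
    using (x∙yz≈y∙xz)
  open ≡-Reasoning

  Σ-anti : (ℕ → ℕ → ℚ) → ℕ → ℚ
  Σ-anti f zero    = f 0 0
  Σ-anti f (suc n) = f (suc n) 0 +ℚ Σ-anti (λ m j → f m (suc j)) n

  Σ-anti-cong : ∀ {f g} n → (∀ m j → m + j ≡ n → f m j ≡ g m j) → Σ-anti f n ≡ Σ-anti g n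
  Σ-anti-cong zero    f≡g = f≡g 0 0 refl
  Σ-anti-cong (suc n) f≡g = cong₂ _+ℚ_ (f≡g (suc n) 0 (+-identityʳ (suc n)))
    (Σ-anti-cong n (λ m j m+j≡n → f≡g m (suc j) (trans (+-suc m j) (cong suc m+j≡n))))

  Σ-anti-closed : (Q : ℚ → Set) → (∀ {q r} → Q q → Q r → Q (q +ℚ r)) →
                  ∀ {f} n → (∀ m j → m + j ≡ n → Q (f m j)) → Q (Σ-anti f n)
  Σ-anti-closed Q Q-+ zero    Qf = Qf 0 0 refl
  Σ-anti-closed Q Q-+ (suc n) Qf = Q-+ (Qf (suc n) 0 (+-identityʳ (suc n)))
    (Σ-anti-closed Q Q-+ n (λ m j m+j≡n → Qf m (suc j) (trans (+-suc m j) (cong suc m+j≡n))))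

  Σ-anti-map : (h : ℚ → ℚ) → (∀ q r → h (q +ℚ r) ≡ h q +ℚ h r) →
               ∀ f n → Σ-anti (λ m j → h (f m j)) n ≡ h (Σ-anti f n)
  Σ-anti-map h h-+ f zero    = refl
  Σ-anti-map h h-+ f (suc n) =
    trans (cong (h (f (suc n) 0) +ℚ_) (Σ-anti-map h h-+ (λ m j → f m (suc j)) n)) (sym (h-+ _ _))

  Σ-anti-zip : (_∙_ : ℚ → ℚ → ℚ) → (∀ q r s t → (q ∙ r) +ℚ (s ∙ t) ≡ (q +ℚ s) ∙ (r +ℚ t)) →
               ∀ f g n → Σ-anti (λ m j → f m j ∙ g m j) n ≡ Σ-anti f n ∙ Σ-anti g n
  Σ-anti-zip _∙_ interchange f g zero    = refl
  Σ-anti-zip _∙_ interchange f g (suc n) =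
    trans (cong ((f (suc n) 0 ∙ g (suc n) 0) +ℚ_) (Σ-anti-zip _∙_ interchange (λ m j → f m (suc j)) (λ m j → g m (suc j)) n))
          (interchange _ _ _ _)

  Σ-anti-peel-m0 : ∀ f n → Σ-anti f (suc n) ≡ f 0 (suc n) +ℚ Σ-anti (λ m j → f (suc m) j) n
  Σ-anti-peel-m0 f zero    = ℚP.+-comm (f 1 0) (f 0 1)
  Σ-anti-peel-m0 f (suc n) =
    trans (cong (f (suc (suc n)) 0 +ℚ_) (Σ-anti-peel-m0 (λ m j → f m (suc j)) n))
          (x∙yz≈y∙xz (f (suc (suc n)) 0) (f 0 (suc (suc n))) (Σ-anti (λ m j → f (suc m) (suc j)) n))

  Σ-anti-cumulative : ∀ g c → (∀ m → g m 0 ≡ c m 0) → (∀ m r → g m (suc r) ≡ g m r +ℚ c m (suc r)) →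
                      ∀ n → Σ-anti g (suc n) ≡ Σ-anti g n +ℚ Σ-anti c (suc n)
  Σ-anti-cumulative g c g₀ gₛ n = begin
      g (suc n) 0 +ℚ Σ-anti (λ m j → g m (suc j)) n
        ≡⟨ cong₂ _+ℚ_ (g₀ (suc n)) (Σ-anti-cong n (λ m j _ → gₛ m j)) ⟩
      c (suc n) 0 +ℚ Σ-anti (λ m j → g m j +ℚ c m (suc j)) n
        ≡⟨ cong (c (suc n) 0 +ℚ_) (Σ-anti-zip _+ℚ_ (solve-∀ ℚ-ring) g (λ m j → c m (suc j)) n) ⟩
      c (suc n) 0 +ℚ (Σ-anti g n +ℚ Σ-anti (λ m j → c m (suc j)) n)
        ≡⟨ x∙yz≈y∙xz (c (suc n) 0) (Σ-anti g n) (Σ-anti (λ m j → c m (suc j)) n) ⟩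
      Σ-anti g n +ℚ (c (suc n) 0 +ℚ Σ-anti (λ m j → c m (suc j)) n) ∎

module PowerSums (x y : ℚ.ℚ) (x+y≡x*y : x ℚ.+ y ≡ x ℚ.* y) where
  open import Data.Nat using (ℕ; zero; suc)
  open import Data.Rational using (ℚ; 0ℚ; 1ℚ; _+_; _*_; _-_)
  open RationalArithmetic
  open SignedBinomial
  open AntidiagonalSum
  open import Tactic.RingSolver using (solve-∀)
  open ≡-Reasoning

  e : ℚ
  e = x + y

  σ : ℕ → ℚ
  σ k = x ^ℚ k + y ^ℚ k

  σ-rec : ∀ k → σ (suc (suc k)) ≡ e * σ (suc k) - e * σ k
  σ-rec k = trans (newton x y (x ^ℚ k) (y ^ℚ k)) (cong (λ t → e * σ (suc k) - t * σ k) (sym x+y≡x*y))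
    where
    newton : ∀ x y X Y → x * (x * X) + y * (y * Y) ≡ (x + y) * (x * X + y * Y) - (x * y) * (X + Y)
    newton = solve-∀ ℚ-ring

  waringSum : ℕ → ℚ
  waringSum = Σ-anti (λ m j → fromℤ (ω m j) * e ^ℚ m)

  waringSum-rec : ∀ k → waringSum (suc (suc k)) ≡ e * waringSum (suc k) - e * waringSum k
  waringSum-rec k = begin
      waringSum (suc (suc k))
        ≡⟨ Σ-anti-peel-m0 f (suc k) ⟩
      0ℚ * 1ℚ + (1ℚ * (e * e ^ℚ suc k) + Σ-anti (λ m j → f (suc m) (suc j)) k)
        ≡⟨ cong (λ t → 0ℚ * 1ℚ + (1ℚ * (e * e ^ℚ suc k) + t)) inner≡ ⟩
      0ℚ * 1ℚ + (1ℚ * (e * e ^ℚ suc k) + (e * Σ-anti (λ m j → f m (suc j)) k - e * waringSum k))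
        ≡⟨ regroup e (e ^ℚ suc k) (Σ-anti (λ m j → f m (suc j)) k) (waringSum k) ⟩
      e * waringSum (suc k) - e * waringSum k ∎
    where
    f : ℕ → ℕ → ℚ
    f m j = fromℤ (ω m j) * e ^ℚ m
    f-suc-suc : ∀ m j → f (suc m) (suc j) ≡ e * f m (suc j) - e * f m j
    f-suc-suc m j = trans (cong (λ w → fromℤ w * (e * e ^ℚ m)) (ω-suc-suc m j))
                          (trans (cong (_* (e * e ^ℚ m)) (fromℤ-minus (ω m (suc j)) (ω m j)))
                                 (distribute (fromℤ (ω m (suc j))) (fromℤ (ω m j)) e (e ^ℚ m)))
      where
      distribute : ∀ w v e E → (w - v) * (e * E) ≡ e * (w * E) - e * (v * E)
      distribute = solve-∀ ℚ-ring
    inner≡ : Σ-anti (λ m j → f (suc m) (suc j)) k ≡ e * Σ-anti (λ m j → f m (suc j)) k - e * waringSum k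
    inner≡ = begin
      Σ-anti (λ m j → f (suc m) (suc j)) k
        ≡⟨ Σ-anti-cong k (λ m j _ → f-suc-suc m j) ⟩
      Σ-anti (λ m j → e * f m (suc j) - e * f m j) k
        ≡⟨ Σ-anti-zip _-_ (solve-∀ ℚ-ring) _ _ k ⟩
      Σ-anti (λ m j → e * f m (suc j)) k - Σ-anti (λ m j → e * f m j) k
        ≡⟨ cong₂ _-_ (Σ-anti-map (e *_) (ℚP.*-distribˡ-+ e) _ k) (Σ-anti-map (e *_) (ℚP.*-distribˡ-+ e) f k) ⟩
      e * Σ-anti (λ m j → f m (suc j)) k - e * waringSum k ∎
    regroup : ∀ e E X Y → 0ℚ * 1ℚ + (1ℚ * (e * E) + (e * X - e * Y)) ≡ e * (1ℚ * E + X) - e * Y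
    regroup = solve-∀ ℚ-ring

  σ≡waringSum : ∀ k → σ k ≡ waringSum k
  σ≡waringSum zero          = refl
  σ≡waringSum (suc zero)    = linear x y
    where
    linear : ∀ x y → x * 1ℚ + y * 1ℚ ≡ 1ℚ * ((x + y) * 1ℚ) + 0ℚ * 1ℚ
    linear = solve-∀ ℚ-ring
  σ≡waringSum (suc (suc k)) = begin
    σ (suc (suc k))                         ≡⟨ σ-rec k ⟩
    e * σ (suc k) - e * σ k                 ≡⟨ cong₂ (λ s t → e * s - e * t) (σ≡waringSum (suc k)) (σ≡waringSum k) ⟩
    e * waringSum (suc k) - e * waringSum k ≡⟨ waringSum-rec k ⟨
    waringSum (suc (suc k)) ∎

  -- e^m / m; the junk value inv 0 = 0 makes the term m = 0 vanish
  logTerm : ℕ → ℚ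
  logTerm m = e ^ℚ m * inv (fromℤ (+ m))

  waringTerm≡logTerm : ∀ m j → fromℤ (ω (suc m) j) * e ^ℚ suc m * inv (fromℤ (+ (suc m ℕ.+ j)))
                             ≡ logTerm (suc m) * fromℤ (β (suc m) j)
  waringTerm≡logTerm m j = begin
      w * E * inv K   ≡⟨ swap w E (inv K) ⟩
      w * inv K * E   ≡⟨ cong (_* E) (*-inv-cross (fromℤ-suc≢0 m) (fromℤ-suc≢0 (m ℕ.+ j)) cross) ⟩
      b * inv M * E   ≡⟨ swap′ b (inv M) E ⟩
      E * inv M * b ∎
    where
    w = fromℤ (ω (suc m) j)
    b = fromℤ (β (suc m) j)
    E = e ^ℚ suc m
    M = fromℤ (+ suc m)
    K = fromℤ (+ (suc m ℕ.+ j))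
    cross : M * w ≡ K * b
    cross = trans (sym (fromℤ-* (+ suc m) (ω (suc m) j)))
                  (trans (cong fromℤ (ω-β m j)) (fromℤ-* (+ (suc m ℕ.+ j)) (β (suc m) j)))
    swap : ∀ w E i → w * E * i ≡ w * i * E
    swap = solve-∀ ℚ-ring
    swap′ : ∀ b i E → b * i * E ≡ E * i * b
    swap′ = solve-∀ ℚ-ring

  σ/k≡Σ-anti : ∀ k → σ (suc k) * inv (fromℤ (+ suc k)) ≡ Σ-anti (λ m j → logTerm m * fromℤ (β m j)) (suc k)
  σ/k≡Σ-anti k = begin
      σ (suc k) * iK
        ≡⟨ cong (_* iK) (σ≡waringSum (suc k)) ⟩
      waringSum (suc k) * iK
        ≡⟨ Σ-anti-map (_* iK) (λ q r → ℚP.*-distribʳ-+ iK q r) (λ m j → fromℤ (ω m j) * e ^ℚ m) (suc k) ⟨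
      Σ-anti (λ m j → fromℤ (ω m j) * e ^ℚ m * iK) (suc k)
        ≡⟨ Σ-anti-cong (suc k) termwise ⟩
      Σ-anti (λ m j → logTerm m * fromℤ (β m j)) (suc k) ∎
    where
    iK = inv (fromℤ (+ suc k))
    termwise : ∀ m j → m ℕ.+ j ≡ suc k → fromℤ (ω m j) * e ^ℚ m * iK ≡ logTerm m * fromℤ (β m j)
    termwise zero    (suc j) _ = trans (ℚP.*-zeroˡ iK) (sym (ℚP.*-zeroʳ (logTerm 0)))
    termwise (suc m) j m+j≡k = subst (λ n → fromℤ (ω (suc m) j) * e ^ℚ suc m * inv (fromℤ (+ n)) ≡ logTerm (suc m) * fromℤ (β (suc m) j))
                                     m+j≡k (waringTerm≡logTerm m j)

  logSeries : ℕ → ℚ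
  logSeries zero    = 0ℚ
  logSeries (suc n) = logSeries n + σ (suc n) * inv (fromℤ (+ suc n))

  logSeries≡Σ-anti : ∀ n → logSeries n ≡ Σ-anti (λ m r → logTerm m * fromℤ (alternatingSum m r)) n
  logSeries≡Σ-anti zero    = refl
  logSeries≡Σ-anti (suc n) = begin
      logSeries n + σ (suc n) * inv (fromℤ (+ suc n))
        ≡⟨ cong₂ _+_ (logSeries≡Σ-anti n) (σ/k≡Σ-anti n) ⟩
      Σ-anti g n + Σ-anti c (suc n)
        ≡⟨ Σ-anti-cumulative g c (λ _ → refl) g-suc n ⟨
      Σ-anti g (suc n) ∎
    where
    g c : ℕ → ℕ → ℚ
    g m r = logTerm m * fromℤ (alternatingSum m r)
    c m j = logTerm m * fromℤ (β m j)
    g-suc : ∀ m r → g m (suc r) ≡ g m r + c m (suc r)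
    g-suc m r = trans (cong (logTerm m *_) (fromℤ-+ (alternatingSum m r) (β m (suc r))))
                      (ℚP.*-distribˡ-+ (logTerm m) _ _)

module PAdic {p : ℕ} (p-prime : Prime p) where
  open import Data.Nat using (_≤_; _∸_; _>_; z≤n; s≤s)
  open import Data.Rational using (_+_; _*_; 1ℚ)
  open import Algebra.Bundles using (CommutativeMonoid)
  open import Algebra.Properties.CommutativeSemigroup (CommutativeMonoid.commutativeSemigroup ℚP.*-1-commutativeMonoid)
    using (interchange)
  open RationalArithmetic
  open Valuation
  open ≡-Reasoning

  p∤* : ∀ z w → ¬ + p ∣ z → ¬ + p ∣ w → ¬ + p ∣ z ℤ.* w
  p∤* z w p∤z p∤w p∣zw = prime∤* p-prime p∤z p∤w (subst (p ℕD.∣_) (ℤP.abs-* z w) p∣zw)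

  p∤1 : ¬ + p ∣ + 1
  p∤1 = >1⇒∤1 (prime⇒>1 p-prime)

  pos-p^+ : ∀ K L → + (p ℕ.^ (K ℕ.+ L)) ≡ + (p ℕ.^ K) ℤ.* + (p ℕ.^ L)
  pos-p^+ K L = trans (cong +_ (ℕP.^-distribˡ-+-* p K L)) (ℤP.pos-* (p ℕ.^ K) (p ℕ.^ L))

  -- K ≤v q: q lies in p^K ℤ₍ₚ₎, i.e. q = 0 or ϑ_p(q) ≥ K
  record _≤v_ (K : ℕ) (q : ℚ.ℚ) : Set where
    constructor ≤v-by
    field
      multiplier : ℤ
      unit       : ℤ
      p∤unit     : ¬ + p ∣ unit
      equation   : q * fromℤ unit ≡ fromℤ (+ (p ℕ.^ K) ℤ.* multiplier)

  ≤v-0 : ∀ K → K ≤v 0ℚ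
  ≤v-0 K = ≤v-by (+ 0) (+ 1) p∤1 (cong fromℤ (sym (ℤP.*-zeroʳ (+ (p ℕ.^ K)))))

  ≤v-fromℤ : ∀ z → 0 ≤v fromℤ z
  ≤v-fromℤ z = ≤v-by z (+ 1) p∤1 (trans (ℚP.*-identityʳ (fromℤ z)) (cong fromℤ (sym (ℤP.*-identityˡ z))))

  ≤v-mono : ∀ {K L q} → L ≤ K → K ≤v q → L ≤v q
  ≤v-mono {K} {L} L≤K (≤v-by c d p∤d eq) = ≤v-by (+ (p ℕ.^ (K ∸ L)) ℤ.* c) d p∤d
    (trans eq (cong fromℤ (begin
      + (p ℕ.^ K) ℤ.* c                             ≡⟨ cong (λ n → + (p ℕ.^ n) ℤ.* c) (ℕP.m+[n∸m]≡n L≤K) ⟨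
      + (p ℕ.^ (L ℕ.+ (K ∸ L))) ℤ.* c               ≡⟨ cong (ℤ._* c) (pos-p^+ L (K ∸ L)) ⟩
      + (p ℕ.^ L) ℤ.* + (p ℕ.^ (K ∸ L)) ℤ.* c       ≡⟨ ℤP.*-assoc (+ (p ℕ.^ L)) _ c ⟩
      + (p ℕ.^ L) ℤ.* (+ (p ℕ.^ (K ∸ L)) ℤ.* c) ∎)))

  ≤v-+ : ∀ {K q r} → K ≤v q → K ≤v r → K ≤v (q + r)
  ≤v-+ {K} {q} {r} (≤v-by c₁ d₁ p∤d₁ eq₁) (≤v-by c₂ d₂ p∤d₂ eq₂) =
    ≤v-by (c₁ ℤ.* d₂ ℤ.+ c₂ ℤ.* d₁) (d₁ ℤ.* d₂) (p∤* d₁ d₂ p∤d₁ p∤d₂) (begin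
      (q + r) * fromℤ (d₁ ℤ.* d₂)                  ≡⟨ cong ((q + r) *_) (fromℤ-* d₁ d₂) ⟩
      (q + r) * (D₁ * D₂)                          ≡⟨ distribute q r D₁ D₂ ⟩
      q * D₁ * D₂ + r * D₂ * D₁                     ≡⟨ cong₂ (λ s t → s * D₂ + t * D₁) eq₁ eq₂ ⟩
      fromℤ (pᴷ ℤ.* c₁) * D₂ + fromℤ (pᴷ ℤ.* c₂) * D₁ ≡⟨ cong₂ _+_ (fromℤ-* (pᴷ ℤ.* c₁) d₂) (fromℤ-* (pᴷ ℤ.* c₂) d₁) ⟨
      fromℤ (pᴷ ℤ.* c₁ ℤ.* d₂) + fromℤ (pᴷ ℤ.* c₂ ℤ.* d₁) ≡⟨ fromℤ-+ (pᴷ ℤ.* c₁ ℤ.* d₂) (pᴷ ℤ.* c₂ ℤ.* d₁) ⟨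
      fromℤ (pᴷ ℤ.* c₁ ℤ.* d₂ ℤ.+ pᴷ ℤ.* c₂ ℤ.* d₁)  ≡⟨ cong fromℤ (factor pᴷ c₁ c₂ d₁ d₂) ⟩
      fromℤ (pᴷ ℤ.* (c₁ ℤ.* d₂ ℤ.+ c₂ ℤ.* d₁)) ∎)
    where
    pᴷ = + (p ℕ.^ K)
    D₁ = fromℤ d₁
    D₂ = fromℤ d₂
    distribute : ∀ q r D₁ D₂ → (q + r) * (D₁ * D₂) ≡ q * D₁ * D₂ + r * D₂ * D₁
    distribute = RingSolver.solve-∀ ℚ-ring
    factor : ∀ P c₁ c₂ d₁ d₂ → P ℤ.* c₁ ℤ.* d₂ ℤ.+ P ℤ.* c₂ ℤ.* d₁ ≡ P ℤ.* (c₁ ℤ.* d₂ ℤ.+ c₂ ℤ.* d₁)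
    factor = ℤSolver.solve-∀

  ≤v-* : ∀ {K L q r} → K ≤v q → L ≤v r → (K ℕ.+ L) ≤v (q * r)
  ≤v-* {K} {L} {q} {r} (≤v-by c₁ d₁ p∤d₁ eq₁) (≤v-by c₂ d₂ p∤d₂ eq₂) =
    ≤v-by (c₁ ℤ.* c₂) (d₁ ℤ.* d₂) (p∤* d₁ d₂ p∤d₁ p∤d₂) (begin
      q * r * fromℤ (d₁ ℤ.* d₂)              ≡⟨ cong (q * r *_) (fromℤ-* d₁ d₂) ⟩
      q * r * (fromℤ d₁ * fromℤ d₂)          ≡⟨ interchange q r (fromℤ d₁) (fromℤ d₂) ⟩
      q * fromℤ d₁ * (r * fromℤ d₂)          ≡⟨ cong₂ _*_ eq₁ eq₂ ⟩
      fromℤ (pᴷ ℤ.* c₁) * fromℤ (pᴸ ℤ.* c₂)   ≡⟨ fromℤ-* (pᴷ ℤ.* c₁) (pᴸ ℤ.* c₂) ⟨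
      fromℤ (pᴷ ℤ.* c₁ ℤ.* (pᴸ ℤ.* c₂))       ≡⟨ cong fromℤ (ℤ-interchange pᴷ c₁ pᴸ c₂) ⟩
      fromℤ (pᴷ ℤ.* pᴸ ℤ.* (c₁ ℤ.* c₂))       ≡⟨ cong (λ P → fromℤ (P ℤ.* (c₁ ℤ.* c₂))) (pos-p^+ K L) ⟨
      fromℤ (+ (p ℕ.^ (K ℕ.+ L)) ℤ.* (c₁ ℤ.* c₂)) ∎)
    where
    pᴷ = + (p ℕ.^ K)
    pᴸ = + (p ℕ.^ L)
    ℤ-interchange : ∀ a b c d → a ℤ.* b ℤ.* (c ℤ.* d) ≡ a ℤ.* c ℤ.* (b ℤ.* d)
    ℤ-interchange = ℤSolver.solve-∀

  ≤v-^ : ∀ {K q} → K ≤v q → ∀ m → (m ℕ.* K) ≤v (q ^ℚ m)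
  ≤v-^ K≤vq zero    = ≤v-by (+ 1) (+ 1) p∤1 refl
  ≤v-^ K≤vq (suc m) = ≤v-* K≤vq (≤v-^ K≤vq m)

  ≤v-/ : ∀ {K q v u} → K ≤v q → ¬ p ℕD.∣ u → v ≤ K → (K ∸ v) ≤v (q * inv (fromℤ (+ (p ℕ.^ v ℕ.* u))))
  ≤v-/ {K} {q} {v} {u} (≤v-by c d p∤d eq) p∤u v≤K = ≤v-by c (d ℤ.* + u) (p∤* d (+ u) p∤d p∤u) (*-cancelʳ N≢0 (begin
      q * inv N * fromℤ (d ℤ.* + u) * N    ≡⟨ cong (λ t → q * inv N * t * N) (fromℤ-* d (+ u)) ⟩
      q * inv N * (D * U) * N              ≡⟨ regroup q (inv N) D U N ⟩
      q * D * U * (N * inv N)              ≡⟨ cong₂ (λ s t → s * U * t) eq (inv-inverseʳ N≢0) ⟩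
      fromℤ (pᴷ ℤ.* c) * U * 1ℚ            ≡⟨ ℚP.*-identityʳ _ ⟩
      fromℤ (pᴷ ℤ.* c) * U                 ≡⟨ fromℤ-* (pᴷ ℤ.* c) (+ u) ⟨
      fromℤ (pᴷ ℤ.* c ℤ.* + u)             ≡⟨ cong fromℤ split ⟩
      fromℤ (pᴷ⁻ᵛ ℤ.* c ℤ.* + (p ℕ.^ v ℕ.* u)) ≡⟨ fromℤ-* (pᴷ⁻ᵛ ℤ.* c) _ ⟩
      fromℤ (pᴷ⁻ᵛ ℤ.* c) * N ∎))
    where
    N = fromℤ (+ (p ℕ.^ v ℕ.* u))
    D = fromℤ d
    U = fromℤ (+ u)
    pᴷ = + (p ℕ.^ K)
    pᴷ⁻ᵛ = + (p ℕ.^ (K ∸ v))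
    N≢0 : N ≢ 0ℚ
    N≢0 = fromℤ-nonZero {+ (p ℕ.^ v ℕ.* u)} λ eq → ℕP.>⇒≢ (p^v*u>0 (prime⇒>1 p-prime) v p∤u) (ℤP.+-injective eq)
    regroup : ∀ q i D U N → q * i * (D * U) * N ≡ q * D * U * (N * i)
    regroup = RingSolver.solve-∀ ℚ-ring
    reassociate : ∀ a b c d → a ℤ.* b ℤ.* c ℤ.* d ≡ a ℤ.* c ℤ.* (b ℤ.* d)
    reassociate = ℤSolver.solve-∀
    split : pᴷ ℤ.* c ℤ.* + u ≡ pᴷ⁻ᵛ ℤ.* c ℤ.* + (p ℕ.^ v ℕ.* u)
    split = begin
      pᴷ ℤ.* c ℤ.* + u                        ≡⟨ cong (λ k → + (p ℕ.^ k) ℤ.* c ℤ.* + u) (ℕP.m∸n+n≡m v≤K) ⟨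
      + (p ℕ.^ (K ∸ v ℕ.+ v)) ℤ.* c ℤ.* + u   ≡⟨ cong (λ P → P ℤ.* c ℤ.* + u) (pos-p^+ (K ∸ v) v) ⟩
      pᴷ⁻ᵛ ℤ.* + (p ℕ.^ v) ℤ.* c ℤ.* + u      ≡⟨ reassociate pᴷ⁻ᵛ (+ (p ℕ.^ v)) c (+ u) ⟩
      pᴷ⁻ᵛ ℤ.* c ℤ.* (+ (p ℕ.^ v) ℤ.* + u)    ≡⟨ cong (pᴷ⁻ᵛ ℤ.* c ℤ.*_) (ℤP.pos-* (p ℕ.^ v) u) ⟨
      pᴷ⁻ᵛ ℤ.* c ℤ.* + (p ℕ.^ v ℕ.* u) ∎

  ≤v⇒≤ϑ : ∀ {K q} → q ≢ 0ℚ → K ≤v q → + K ℤ.≤ ϑ p q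
  ≤v⇒≤ϑ {K} {q} q≢0 (≤v-by c d p∤d eq) = subst (+ K ℤ.≤_) (sym ϑ≡) (ℤ.+≤+ (ℕP.m≤m+n K (vℕ p ℤ.∣ c ∣)))
    where
    n = ℤ.∣ ℚ.↥ q ∣
    m = ℚ.↧ₙ q
    cross : n ℕ.* ℤ.∣ d ∣ ≡ p ℕ.^ K ℕ.* ℤ.∣ c ∣ ℕ.* m
    cross = begin
      n ℕ.* ℤ.∣ d ∣                      ≡⟨ ℤP.abs-* (ℚ.↥ q) d ⟨
      ℤ.∣ ℚ.↥ q ℤ.* d ∣                  ≡⟨ cong ℤ.∣_∣ (*fromℤ≡fromℤ⇒cross q d (+ (p ℕ.^ K) ℤ.* c) eq) ⟩
      ℤ.∣ + (p ℕ.^ K) ℤ.* c ℤ.* ℚ.↧ q ∣  ≡⟨ ℤP.abs-* (+ (p ℕ.^ K) ℤ.* c) (ℚ.↧ q) ⟩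
      ℤ.∣ + (p ℕ.^ K) ℤ.* c ∣ ℕ.* m      ≡⟨ cong (ℕ._* m) (ℤP.abs-* (+ (p ℕ.^ K)) c) ⟩
      p ℕ.^ K ℕ.* ℤ.∣ c ∣ ℕ.* m ∎
    n>0 : n > 0
    n>0 = ℕP.n≢0⇒n>0 (λ n≡0 → q≢0 (ℚP.↥p≡0⇒p≡0 q (ℤP.∣i∣≡0⇒i≡0 n≡0)))
    d>0 : ℤ.∣ d ∣ > 0
    d>0 = ℕP.n≢0⇒n>0 (λ d≡0 → p∤d (subst (p ℕD.∣_) (sym d≡0) (ℕD._∣0 p)))
    ϑ≡ : ϑ p q ≡ + (K ℕ.+ vℕ p ℤ.∣ c ∣)
    ϑ≡ = begin
      + vℕ p n ℤ.- + vℕ p m                                     ≡⟨ cong (λ k → + k ℤ.- + vℕ p m) (vℕ-cross p-prime {c = ℤ.∣ c ∣} {K = K} n>0 d>0 p∤d ℕ.z<s cross) ⟩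
      + (K ℕ.+ vℕ p ℤ.∣ c ∣ ℕ.+ vℕ p m) ℤ.- + vℕ p m           ≡⟨ cong (ℤ._- + vℕ p m) (ℤP.pos-+ (K ℕ.+ vℕ p ℤ.∣ c ∣) (vℕ p m)) ⟩
      + (K ℕ.+ vℕ p ℤ.∣ c ∣) ℤ.+ + vℕ p m ℤ.- + vℕ p m          ≡⟨ cancel (+ (K ℕ.+ vℕ p ℤ.∣ c ∣)) (+ vℕ p m) ⟩
      + (K ℕ.+ vℕ p ℤ.∣ c ∣) ∎
      where
      cancel : ∀ a b → a ℤ.+ b ℤ.- b ≡ a
      cancel = ℤSolver.solve-∀

module ReciprocalPair {p : ℕ} (p-prime : Prime p) {a : ℤ} (p∤a : ¬ + p ∣ a) where
  open import Data.Rational using (ℚ; 0ℚ; _+_; _*_)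
  open import Data.Nat using (_≤_; _∸_; _>_; s≤s)
  open RationalArithmetic
  open SignedBinomial
  open AntidiagonalSum
  open Valuation
  open PAdic p-prime
  open ≡-Reasoning

  A B P : ℚ
  A = fromℤ a
  B = fromℤ (+ p ℤ.- a)
  P = fromℤ (+ p)

  p∤p-a : ¬ + p ∣ (+ p ℤ.- a)
  p∤p-a p∣p-a = p∤a (ℤD.∣⇒∣ᵤ (subst (ℤD._∣_ (+ p)) (ℤP.neg-involutive a)
                                 (ℤD.∣m⇒∣-m (ℤD.∣m+n∣m⇒∣n (ℤD.∣ᵤ⇒∣ p∣p-a) ℤD.∣-refl))))

  fromℤ-p-unit≢0 : ∀ z → ¬ + p ∣ z → fromℤ z ≢ 0ℚ
  fromℤ-p-unit≢0 z p∤z = fromℤ-nonZero {z} λ z≡0 → p∤z (subst (λ w → + p ∣ w) (sym z≡0) (p ℕD.∣0))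

  A≢0 : A ≢ 0ℚ
  A≢0 = fromℤ-p-unit≢0 a p∤a

  B≢0 : B ≢ 0ℚ
  B≢0 = fromℤ-p-unit≢0 (+ p ℤ.- a) p∤p-a

  A+B≡P : A + B ≡ P
  A+B≡P = trans (sym (fromℤ-+ a (+ p ℤ.- a))) (cong fromℤ (a+[p-a]≡p a (+ p)))
    where
    a+[p-a]≡p : ∀ a p → a ℤ.+ (p ℤ.- a) ≡ p
    a+[p-a]≡p = ℤSolver.solve-∀

  x y : ℚ
  x = P * inv A
  y = P * inv B

  P/D*D≡P : ∀ {D} → D ≢ 0ℚ → P * inv D * D ≡ P
  P/D*D≡P {D} D≢0 = trans (ℚP.*-assoc P (inv D) D) (trans (cong (P *_) (inv-inverseˡ D≢0)) (ℚP.*-identityʳ P))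

  [x+y]*AB≡P*P : (x + y) * (A * B) ≡ P * P
  [x+y]*AB≡P*P = begin
    (x + y) * (A * B)       ≡⟨ distribute x y A B ⟩
    x * A * B + y * B * A   ≡⟨ cong₂ (λ s t → s * B + t * A) (P/D*D≡P A≢0) (P/D*D≡P B≢0) ⟩
    P * B + P * A           ≡⟨ factor P A B ⟩
    P * (A + B)             ≡⟨ cong (P *_) A+B≡P ⟩
    P * P ∎
    where
    distribute : ∀ x y A B → (x + y) * (A * B) ≡ x * A * B + y * B * A
    distribute = RingSolver.solve-∀ ℚ-ring
    factor : ∀ P A B → P * B + P * A ≡ P * (A + B)
    factor = RingSolver.solve-∀ ℚ-ring

  x+y≡x*y : x + y ≡ x * y
  x+y≡x*y = *-cancelʳ (*-nonZero A≢0 B≢0) (begin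
    (x + y) * (A * B)     ≡⟨ [x+y]*AB≡P*P ⟩
    P * P                 ≡⟨ cong₂ _*_ (P/D*D≡P A≢0) (P/D*D≡P B≢0) ⟨
    (x * A) * (y * B)     ≡⟨ interchange x A y B ⟩
    x * y * (A * B) ∎)
    where
    interchange : ∀ x A y B → (x * A) * (y * B) ≡ x * y * (A * B)
    interchange = RingSolver.solve-∀ ℚ-ring

  open PowerSums x y x+y≡x*y

  e-≤v : 2 ≤v e
  e-≤v = ≤v-by (+ 1) (a ℤ.* (+ p ℤ.- a)) (p∤* a (+ p ℤ.- a) p∤a p∤p-a) (begin
    e * fromℤ (a ℤ.* (+ p ℤ.- a))  ≡⟨ cong (e *_) (fromℤ-* a (+ p ℤ.- a)) ⟩
    e * (A * B)                    ≡⟨ [x+y]*AB≡P*P ⟩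
    P * P                          ≡⟨ fromℤ-* (+ p) (+ p) ⟨
    fromℤ (+ p ℤ.* + p)            ≡⟨ cong fromℤ p*p≡p²*1 ⟩
    fromℤ (+ (p ℕ.^ 2) ℤ.* + 1) ∎)
    where
    p*p≡p²*1 : + p ℤ.* + p ≡ + (p ℕ.^ 2) ℤ.* + 1
    p*p≡p²*1 = trans (sym (ℤP.pos-* p p)) (trans (cong (λ n → + (p ℕ.* n)) (sym (ℕP.*-identityʳ p))) (sym (ℤP.*-identityʳ _)))

  term≡σ/k : ∀ k → term p a k ≡ σ k * inv (fromℤ (+ k))
  term≡σ/k k = cong (_* inv (fromℤ (+ k))) (begin
    (inv (A ^ℚ k) + inv (B ^ℚ k)) * P ^ℚ k          ≡⟨ cong₂ (λ s t → (s + t) * P ^ℚ k) (inv-^ k A≢0) (inv-^ k B≢0) ⟩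
    (inv A ^ℚ k + inv B ^ℚ k) * P ^ℚ k              ≡⟨ distribute (inv A ^ℚ k) (inv B ^ℚ k) (P ^ℚ k) ⟩
    P ^ℚ k * inv A ^ℚ k + P ^ℚ k * inv B ^ℚ k       ≡⟨ cong₂ _+_ (^-distribʳ-* P (inv A) k) (^-distribʳ-* P (inv B) k) ⟨
    σ k ∎)
    where
    distribute : ∀ u v w → (u + v) * w ≡ w * u + w * v
    distribute = RingSolver.solve-∀ ℚ-ring

  S≡logSeries : ∀ n → S p a n ≡ logSeries n
  S≡logSeries zero    = refl
  S≡logSeries (suc n) = cong₂ _+_ (S≡logSeries n) (term≡σ/k (suc n))

  logTerm-≤v : ∀ m → m > 0 → m ≤v logTerm m
  logTerm-≤v m m>0 with factorOut (prime⇒>1 p-prime) m m>0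
  ... | v , u , refl , p∤u = ≤v-mono m≤2m∸v (≤v-/ (≤v-^ e-≤v m) p∤u (ℕP.≤-trans v≤m (ℕP.m≤m*n m 2)))
    where
    v≤m : v ≤ m
    v≤m = subst (_≤ m) (vℕ-unique (prime⇒>1 p-prime) refl p∤u) (vℕ-fuel≤fuel p m m)
    m≤2m∸v : m ≤ m ℕ.* 2 ∸ v
    m≤2m∸v = ℕP.m+n≤o⇒m≤o∸n m (subst (m ℕ.+ v ≤_) (ℕP.*-comm 2 m) (ℕP.+-monoʳ-≤ m (ℕP.≤-trans v≤m (ℕP.m≤m+n m 0))))

  S-≤v : ∀ K → K ≤v S p a (K ℕ.+ K)
  S-≤v K = subst (K ≤v_) (sym (trans (S≡logSeries (K ℕ.+ K)) (logSeries≡Σ-anti (K ℕ.+ K))))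
                 (Σ-anti-closed (K ≤v_) ≤v-+ (K ℕ.+ K) summand-≤v)
    where
    summand-≤v : ∀ m r → m ℕ.+ r ≡ K ℕ.+ K → K ≤v (logTerm m * fromℤ (alternatingSum m r))
    summand-≤v m r _ with m ℕ.≤? K
    ... | no m≰K = ≤v-mono (ℕP.≤-trans (ℕP.<⇒≤ (ℕP.≰⇒> m≰K)) (ℕP.m≤m+n m 0))
                           (≤v-* (logTerm-≤v m (ℕP.≤-<-trans ℕ.z≤n (ℕP.≰⇒> m≰K))) (≤v-fromℤ (alternatingSum m r)))
    summand-≤v zero    r _    | yes _ = subst (K ≤v_) (sym (ℚP.*-zeroˡ (fromℤ (alternatingSum 0 r)))) (≤v-0 K)
    summand-≤v (suc m) r m+r≡ | yes m<K = subst (K ≤v_) (sym vanishes) (≤v-0 K)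
      where
      K≤r : K ≤ r
      K≤r = ℕP.+-cancelˡ-≤ K K r (subst (ℕ._≤ K ℕ.+ r) m+r≡ (ℕP.+-monoˡ-≤ r m<K))
      vanishes : logTerm (suc m) * fromℤ (alternatingSum (suc m) r) ≡ 0ℚ
      vanishes = trans (cong (λ z → logTerm (suc m) * fromℤ z) (trans (alternatingSum-suc m r) (β-vanish (ℕP.≤-trans m<K K≤r))))
                       (ℚP.*-zeroʳ (logTerm (suc m)))

i<+suc∣i∣ : ∀ i → i < + suc ℤ.∣ i ∣
i<+suc∣i∣ (+ n)      = ℤ.+<+ (ℕP.n<1+n n)
i<+suc∣i∣ ℤ.-[1+ n ] = ℤ.-<+

theorem3 : (p : ℕ) → Prime p → (a : ℤ) → ¬ (+ p ∣ a) →
    (M : ℤ) → ∃ λ n → n ≥ 1 × (S p a n ≡ 0ℚ ⊎ M < ϑ p (S p a n))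
theorem3 p p-prime a p∤a M = N ℕ.+ N , ℕ.s≤s ℕ.z≤n , zero-or-large
  where
  N = suc ℤ.∣ M ∣
  zero-or-large : S p a (N ℕ.+ N) ≡ 0ℚ ⊎ M < ϑ p (S p a (N ℕ.+ N))
  zero-or-large with S p a (N ℕ.+ N) ℚP.≟ 0ℚ
  ... | yes S≡0 = inj₁ S≡0
  ... | no  S≢0 = inj₂ (ℤP.<-≤-trans (i<+suc∣i∣ M) (PAdic.≤v⇒≤ϑ p-prime S≢0 (ReciprocalPair.S-≤v p-prime p∤a N)))
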